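{- Let $P$ be a standard, range-restricted logic program in which, whenever a variable $X$ occurs both in a term of the head and in a term of the body of a rule, at most one of these terms is complex, and every complex term has nesting depth at most one. Let $r$ be a rule of $P$. If $M[\![r]\!]$ is infinite, then for every natural number $k\ge1$, the rule $r$ depends on a cycle of $\Sigma_k(P)$.
   Context: A standard rule is $A\leftarrow B_1,\dots,B_k$ with atoms built from constants, variables and function symbols; a program is a finite set of rules. Immediate consequence operator: $T_P(I)=\{A\theta\mid A\leftarrow A_1,\dots,A_n\in P,\ \theta\text{ a ground substitution with }A_i\theta\in I\text{ for all }i\}$; $T_P^0(\emptyset)=\emptyset$, $T_P^i(\emptyset)=T_P(T_P^{i-1}(\emptyset))$. $M[\![r]\!]$ is the set of ground atoms $head(r)\theta$ such that $head(r)\theta\in T_P^i(\emptyset)\setminus T_P^{i-1}(\emptyset)$ for some $i\ge1$ (the facts inferred using $r$). Activation graph $\Sigma(P)$: nodes rules, edge $(r_1,r_2)$ iff $head(r_1)$ unifies with an atom of $body(r_2)$. A path $(r_1,r_2),\dots,(r_k,r_{k+1})$ of $\Sigma(P)$ is active if there are unifiers $\theta_1,\dots,\theta_k$ such that $head(r_1)$ unifies with an atom of $body(r_2)$ via $\theta_1$ and, for $i\in[2..k]$, $head(r_i)\theta_{i-1}$ unifies with an atom of $body(r_{i+1})$ via $\theta_i$. $\Sigma_k(P)$ has the rules as nodes and an edge $(r,s)$ iff there is an active path of length $k$ from $r$ to $s$. A node $r$ depends on a cycle if there is a path from some node of the cycle to $r$ (nodes on the cycle depend on it). -}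

module Defs where

open import Data.Nat using (ℕ; zero; suc)
open import Data.List using (List; []; _∷_)
open import Data.List.Relation.Unary.All using (All)
open import Data.List.Relation.Unary.Any using (Any)
open import Data.List.Membership.Propositional using (_∈_)
open import Data.Product using (Σ; ∃; _×_)
open import Data.Empty using (⊥)
open import Data.Unit using (⊤)
open import Relation.Nullary using (¬_)
open import Relation.Binary.PropositionalEquality using (_≡_)
open import Relation.Binary.Construct.Closure.ReflexiveTransitive using (Star)
open import Relation.Binary.Construct.Closure.Transitive using (TransClosure)

data Term : Set where
  var : ℕ → Term
  con : ℕ → Term
  fn  : ℕ → List Term → Term

record Atom : Set where
  constructor atom
  field
    pred : ℕ
    args : List Term
open Atom public

record Rule : Set where
  constructor _⇐_
  field
    head : Atom
    body : List Atom
open Rule public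

Program : Set
Program = List Rule

Subst : Set
Subst = ℕ → Term

mutual
  _⟪_⟫ : Term → Subst → Term
  var x ⟪ θ ⟫ = θ x
  con c ⟪ θ ⟫ = con c
  fn f ts ⟪ θ ⟫ = fn f (ts ⟪ θ ⟫*)

  _⟪_⟫* : List Term → Subst → List Term
  [] ⟪ θ ⟫* = []
  (t ∷ ts) ⟪ θ ⟫* = t ⟪ θ ⟫ ∷ ts ⟪ θ ⟫*

_·_ : Atom → Subst → Atom
atom p ts · θ = atom p (ts ⟪ θ ⟫*)

data _occursIn_ (x : ℕ) : Term → Set where
  here-var : x occursIn var x
  in-fn    : ∀ {f ts} → Any (x occursIn_) ts → x occursIn fn f ts

_occursInAtom_ : ℕ → Atom → Set
x occursInAtom A = Any (x occursIn_) (args A)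

Ground : Term → Set
Ground t = ∀ x → ¬ (x occursIn t)

GroundAtom : Atom → Set
GroundAtom A = ∀ x → ¬ (x occursInAtom A)

GroundSubst : Subst → Set
GroundSubst θ = ∀ x → Ground (θ x)

data Complex : Term → Set where
  complex : ∀ f ts → Complex (fn f ts)

data Simple : Term → Set where
  simple-var : ∀ x → Simple (var x)
  simple-con : ∀ c → Simple (con c)

DepthLe1 : Term → Set
DepthLe1 (var x) = ⊤
DepthLe1 (con c) = ⊤
DepthLe1 (fn f ts) = All Simple ts

RangeRestricted : Rule → Set
RangeRestricted r =
  ∀ x → x occursInAtom head r → Any (x occursInAtom_) (body r)

AtMostOneComplex : Rule → Set
AtMostOneComplex r =
  ∀ {t s B} x → t ∈ args (head r) → B ∈ body r → s ∈ args B →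
  x occursIn t → x occursIn s → ¬ (Complex t × Complex s)

AtomDepthLe1 : Atom → Set
AtomDepthLe1 A = All DepthLe1 (args A)

RuleDepthLe1 : Rule → Set
RuleDepthLe1 r = AtomDepthLe1 (head r) × All AtomDepthLe1 (body r)

-- Immediate consequence operator iterated from ∅:
-- T P i A  means  A ∈ T_P^i(∅).

T : Program → ℕ → Atom → Set
T P zero A = ⊥
T P (suc i) A =
  Σ Rule λ r → r ∈ P × Σ Subst λ θ → GroundSubst θ ×
    (head r · θ ≡ A) × All (λ B → T P i (B · θ)) (body r)

-- M⟦r⟧: ground atoms head(r)θ inferred using r at some step i+1 and
-- new at that step, i.e. in T^{i+1} \ T^i.
M⟦_⟧ : Rule → Program → Atom → Set
M⟦ r ⟧ P A =
  Σ ℕ λ i → Σ Subst λ θ → GroundSubst θ × (A ≡ head r · θ) ×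
    All (λ B → T P i (B · θ)) (body r) × ¬ T P i A

Finite : (Atom → Set) → Set
Finite S = Σ (List Atom) λ xs → ∀ A → S A → A ∈ xs

Infinite : (Atom → Set) → Set
Infinite S = ¬ Finite S

-- Unification is taken with the two atoms renamed apart:
-- A and B unify iff A·σ ≡ B·θ for some substitutions σ, θ.
-- APath P n H s : there is an active path of length n whose first
-- rule has (instantiated) head H and whose last rule is s; the
-- substitution θ applied to the next rule is propagated to its head.

data APath (P : Program) : ℕ → Atom → Rule → Set where
  last : ∀ {H r B} σ θ → r ∈ P → B ∈ body r →
         H · σ ≡ B · θ → APath P 1 H r
  cons : ∀ {n H r s B} σ θ → r ∈ P → B ∈ body r →
         H · σ ≡ B · θ → APath P (suc n) (head r · θ) s →
         APath P (suc (suc n)) H s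

EdgeΣ : ℕ → Program → Rule → Rule → Set
EdgeΣ k P r s = r ∈ P × s ∈ P × APath P k (head r) s

DependsOnCycle : ℕ → Program → Rule → Set
DependsOnCycle k P r =
  Σ Rule λ c → c ∈ P × TransClosure (EdgeΣ k P) c c × Star (EdgeΣ k P) c r

Admissible : Program → Set
Admissible P = All (λ r → RangeRestricted r × AtMostOneComplex r × RuleDepthLe1 r) P

module Submission where

-- Fix k ≥ 1 and K = (|P| + 1)·k.  A chain of n links into (r, θ) is a
-- sequence of rule instances, each head equal to a body atom of the next,
-- ending in the instance (r, θ).  Either
--   (a) a chain of K links reaches r: its blocks of k links are edges of
--       Σ_k(P) forming a walk of |P| + 1 edges into r, so by pigeonhole a
--       rule repeats and r depends on a cycle; or
--   (b) none does: tracing new premises back shows every fact of M⟦r⟧ is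
--       new at a stage below K, and by range restriction and depth ≤ 1
--       heads such facts are ground atoms of depth ≤ K over the program's
--       signature — finitely many.
-- Deciding (a) constructively is the crux: renaming a chain's rules apart
-- turns "a chain of this shape exists" into solvability of term equations,
-- decided by first-order unification.

open import Defs
open import Data.Nat using (ℕ; zero; suc; _+_; _≤_; _<_; _≥_; _⊔_; z≤n; s≤s; _*_; _≤?_)
import Data.Nat.Properties as ℕₚ
open import Data.Nat.DivMod using (_mod_; m<n⇒m%n≡m)
open import Data.Fin using (Fin; toℕ; punchIn; punchOut) renaming (_≟_ to _≟ᶠ_)
open import Data.Fin.Properties using (toℕ-fromℕ<; punchIn-punchOut)
open import Data.List using (List; []; _∷_; _++_; length; map; concatMap; filter)
open import Data.List.Properties using (∷-injective; filter-notAll; ≡-dec)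
open import Data.List.Relation.Unary.All as All using (All; []; _∷_)
open import Data.List.Relation.Unary.All.Properties using (++⁺; ++⁻ˡ; ++⁻ʳ; ¬Any⇒All¬)
open import Data.List.Relation.Unary.Any using (Any; here; there)
open import Data.List.Relation.Unary.Any.Properties using (++⁺ˡ; ++⁺ʳ)
open import Data.List.Membership.Propositional using (_∈_; lose)
import Data.List.Membership.DecPropositional as DecMembership
open import Data.List.Membership.Propositional.Properties using (∈-filter⁺; ∈-concatMap⁺; ∈-map⁺)
open import Data.List.Relation.Binary.Subset.Propositional using (_⊆_)
open import Data.Product using (Σ; _×_; _,_; proj₁; proj₂; ∃-syntax)
open import Data.Sum using (_⊎_; inj₁; inj₂)
open import Data.Empty using (⊥-elim)
open import Function using (_∘_; const)
open import Function.Bundles using (_⇔_; mk⇔; Equivalence)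
import Function.Properties.Equivalence as ⇔
open import Relation.Nullary using (¬_; Dec; yes; no; ¬?)
open import Relation.Nullary.Decidable using (map′; _×-dec_)
open import Relation.Binary.Definitions using (DecidableEquality)
open import Relation.Binary.PropositionalEquality
  using (_≡_; _≢_; refl; sym; trans; cong; cong₂; subst; module ≡-Reasoning)
open import Relation.Binary.Construct.Closure.ReflexiveTransitive using (Star; ε; _◅_; _◅◅_)
open import Relation.Binary.Construct.Closure.Transitive using (TransClosure; [_]; _∷_)

mutual
  subst-ext : ∀ t {θ₁ θ₂ : Subst} →
              (∀ x → x occursIn t → θ₁ x ≡ θ₂ x) → t ⟪ θ₁ ⟫ ≡ t ⟪ θ₂ ⟫
  subst-ext (var x)   h = h x here-var
  subst-ext (con c)   h = refl
  subst-ext (fn f ts) h = cong (fn f) (subst-ext* ts (λ x o → h x (in-fn o)))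

  subst-ext* : ∀ ts {θ₁ θ₂ : Subst} →
               (∀ x → Any (x occursIn_) ts → θ₁ x ≡ θ₂ x) → ts ⟪ θ₁ ⟫* ≡ ts ⟪ θ₂ ⟫*
  subst-ext* []       h = refl
  subst-ext* (t ∷ ts) h =
    cong₂ _∷_ (subst-ext t (λ x o → h x (here o))) (subst-ext* ts (λ x o → h x (there o)))

mutual
  subst-comp : ∀ t (θ σ : Subst) → t ⟪ θ ⟫ ⟪ σ ⟫ ≡ t ⟪ (λ x → θ x ⟪ σ ⟫) ⟫
  subst-comp (var x)   θ σ = refl
  subst-comp (con c)   θ σ = refl
  subst-comp (fn f ts) θ σ = cong (fn f) (subst-comp* ts θ σ)

  subst-comp* : ∀ ts (θ σ : Subst) → ts ⟪ θ ⟫* ⟪ σ ⟫* ≡ ts ⟪ (λ x → θ x ⟪ σ ⟫) ⟫*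
  subst-comp* []       θ σ = refl
  subst-comp* (t ∷ ts) θ σ = cong₂ _∷_ (subst-comp t θ σ) (subst-comp* ts θ σ)

-- The identity substitution (needed to restart an active path at an
-- already instantiated head).
mutual
  subst-id : ∀ t → t ⟪ var ⟫ ≡ t
  subst-id (var x)   = refl
  subst-id (con c)   = refl
  subst-id (fn f ts) = cong (fn f) (subst-id* ts)

  subst-id* : ∀ ts → ts ⟪ var ⟫* ≡ ts
  subst-id* []       = refl
  subst-id* (t ∷ ts) = cong₂ _∷_ (subst-id t) (subst-id* ts)

subst-length : ∀ ts (θ : Subst) → length (ts ⟪ θ ⟫*) ≡ length ts
subst-length []       θ = refl
subst-length (t ∷ ts) θ = cong suc (subst-length ts θ)

-- An atom p(t₁,…,tₙ) read as the term p(t₁,…,tₙ); this commutes with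
-- substitution, so equations between atoms become equations between terms.
atomTerm : Atom → Term
atomTerm (atom p ts) = fn p ts

atomTerm-subst : ∀ A (θ : Subst) → atomTerm (A · θ) ≡ atomTerm A ⟪ θ ⟫
atomTerm-subst (atom p ts) θ = refl

atomTerm-injective : ∀ {A B} → atomTerm A ≡ atomTerm B → A ≡ B
atomTerm-injective {atom p ts} {atom q us} refl = refl

atom-id : ∀ A → A · var ≡ A
atom-id (atom p ts) = cong (atom p) (subst-id* ts)

-- Equality of rules is decidable (needed to detect repeated rules).
mutual
  _≟ᵗ_ : DecidableEquality Term
  var x    ≟ᵗ var y    = map′ (cong var) (λ { refl → refl }) (x ℕₚ.≟ y)
  con c    ≟ᵗ con d    = map′ (cong con) (λ { refl → refl }) (c ℕₚ.≟ d)
  fn f ts  ≟ᵗ fn g us  =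
    map′ (λ { (refl , refl) → refl }) (λ { refl → refl , refl }) ((f ℕₚ.≟ g) ×-dec (ts ≟ᵗ* us))
  var _    ≟ᵗ con _    = no λ ()
  var _    ≟ᵗ fn _ _   = no λ ()
  con _    ≟ᵗ var _    = no λ ()
  con _    ≟ᵗ fn _ _   = no λ ()
  fn _ _   ≟ᵗ var _    = no λ ()
  fn _ _   ≟ᵗ con _    = no λ ()

  _≟ᵗ*_ : DecidableEquality (List Term)
  []       ≟ᵗ* []       = yes refl
  (t ∷ ts) ≟ᵗ* (u ∷ us) =
    map′ (λ { (refl , refl) → refl }) ∷-injective ((t ≟ᵗ u) ×-dec (ts ≟ᵗ* us))
  []       ≟ᵗ* (_ ∷ _)  = no λ ()
  (_ ∷ _)  ≟ᵗ* []       = no λ ()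

_≟ᵃ_ : DecidableEquality Atom
atom p ts ≟ᵃ atom q us =
  map′ (λ { (refl , refl) → refl }) (λ { refl → refl , refl }) ((p ℕₚ.≟ q) ×-dec (ts ≟ᵗ* us))

_≟ʳ_ : DecidableEquality Rule
(h ⇐ b) ≟ʳ (h′ ⇐ b′) =
  map′ (λ { (refl , refl) → refl }) (λ { refl → refl , refl }) ((h ≟ᵃ h′) ×-dec ≡-dec _≟ᵃ_ b b′)

-- The algorithm works on terms
-- over finitely many variables Fin n: a system is first decomposed into
-- bindings x ≐ t (or refuted by a symbol clash), then the first binding
-- is refuted by the occurs check, dropped if trivial, or eliminated,
-- which leaves a system over one variable fewer.
module Unification where

  data UTerm (n : ℕ) : Set where
    var : Fin n → UTerm n
    con : ℕ → UTerm n
    fn  : ℕ → List (UTerm n) → UTerm n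

  Valuation : ℕ → Set
  Valuation n = Fin n → Term

  mutual
    eval : ∀ {n} → UTerm n → Valuation n → Term
    eval (var i)   σ = σ i
    eval (con c)   σ = con c
    eval (fn f us) σ = fn f (eval* us σ)

    eval* : ∀ {n} → List (UTerm n) → Valuation n → List Term
    eval* []       σ = []
    eval* (u ∷ us) σ = eval u σ ∷ eval* us σ

  mutual
    _⟨_⟩ : ∀ {a b} → UTerm a → (Fin a → UTerm b) → UTerm b
    var i   ⟨ ρ ⟩ = ρ i
    con c   ⟨ ρ ⟩ = con c
    fn f us ⟨ ρ ⟩ = fn f (us ⟨ ρ ⟩*)

    _⟨_⟩* : ∀ {a b} → List (UTerm a) → (Fin a → UTerm b) → List (UTerm b)
    []       ⟨ ρ ⟩* = []
    (u ∷ us) ⟨ ρ ⟩* = u ⟨ ρ ⟩ ∷ us ⟨ ρ ⟩*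

  mutual
    eval-subst : ∀ {a b} u (ρ : Fin a → UTerm b) σ → eval (u ⟨ ρ ⟩) σ ≡ eval u (λ i → eval (ρ i) σ)
    eval-subst (var i)   ρ σ = refl
    eval-subst (con c)   ρ σ = refl
    eval-subst (fn f us) ρ σ = cong (fn f) (eval-subst* us ρ σ)

    eval-subst* : ∀ {a b} us (ρ : Fin a → UTerm b) σ →
                  eval* (us ⟨ ρ ⟩*) σ ≡ eval* us (λ i → eval (ρ i) σ)
    eval-subst* []       ρ σ = refl
    eval-subst* (u ∷ us) ρ σ = cong₂ _∷_ (eval-subst u ρ σ) (eval-subst* us ρ σ)

  mutual
    data Occ {n} (i : Fin n) : UTerm n → Set where
      occ-var : Occ i (var i)
      occ-fn  : ∀ {f us} → Occ* i us → Occ i (fn f us)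

    data Occ* {n} (i : Fin n) : List (UTerm n) → Set where
      occ-here  : ∀ {u us} → Occ i u → Occ* i (u ∷ us)
      occ-there : ∀ {u us} → Occ* i us → Occ* i (u ∷ us)

  mutual
    occ? : ∀ {n} (i : Fin n) u → Dec (Occ i u)
    occ? i (var j) with i ≟ᶠ j
    ... | yes refl = yes occ-var
    ... | no i≢j   = no λ { occ-var → i≢j refl }
    occ? i (con c)   = no λ ()
    occ? i (fn f us) = map′ occ-fn (λ { (occ-fn o) → o }) (occ*? i us)

    occ*? : ∀ {n} (i : Fin n) us → Dec (Occ* i us)
    occ*? i []       = no λ ()
    occ*? i (u ∷ us) with occ? i u | occ*? i us
    ... | yes o | _     = yes (occ-here o)
    ... | no _  | yes o = yes (occ-there o)
    ... | no ¬o | no ¬p = no λ { (occ-here o) → ¬o o ; (occ-there o) → ¬p o }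

  mutual
    eval-ext : ∀ {n} u {σ₁ σ₂ : Valuation n} → (∀ i → Occ i u → σ₁ i ≡ σ₂ i) → eval u σ₁ ≡ eval u σ₂
    eval-ext (var i)   h = h i occ-var
    eval-ext (con c)   h = refl
    eval-ext (fn f us) h = cong (fn f) (eval-ext* us (λ i o → h i (occ-fn o)))

    eval-ext* : ∀ {n} us {σ₁ σ₂ : Valuation n} → (∀ i → Occ* i us → σ₁ i ≡ σ₂ i) →
                eval* us σ₁ ≡ eval* us σ₂
    eval-ext* []       h = refl
    eval-ext* (u ∷ us) h =
      cong₂ _∷_ (eval-ext u (λ i o → h i (occ-here o))) (eval-ext* us (λ i o → h i (occ-there o)))

  -- Occurs check: a variable is never equal to a compound term containing it,
  -- because its value would be strictly smaller than itself.
  mutual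
    size : Term → ℕ
    size (var x)   = 1
    size (con c)   = 1
    size (fn f ts) = suc (size* ts)

    size* : List Term → ℕ
    size* []       = 0
    size* (t ∷ ts) = size t + size* ts

  mutual
    size-occ : ∀ {n} {i : Fin n} {u} σ → Occ i u → size (σ i) ≤ size (eval u σ)
    size-occ σ occ-var    = ℕₚ.≤-refl
    size-occ σ (occ-fn o) = ℕₚ.m≤n⇒m≤1+n (size-occ* σ o)

    size-occ* : ∀ {n} {i : Fin n} {us} σ → Occ* i us → size (σ i) ≤ size* (eval* us σ)
    size-occ* σ (occ-here {u} {us} o) =
      ℕₚ.≤-trans (size-occ σ o) (ℕₚ.m≤m+n (size (eval u σ)) (size* (eval* us σ)))
    size-occ* σ (occ-there {u} {us} o) =
      ℕₚ.≤-trans (size-occ* σ o) (ℕₚ.m≤n+m (size* (eval* us σ)) (size (eval u σ)))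

  occurs-check : ∀ {n} {i : Fin n} {f us} σ → Occ* i us → σ i ≢ eval (fn f us) σ
  occurs-check σ o e = ℕₚ.<-irrefl (cong size e) (s≤s (size-occ* σ o))

  Binding : ℕ → Set
  Binding n = Fin n × UTerm n

  Holds : ∀ {n} → Valuation n → Binding n → Set
  Holds σ (i , u) = σ i ≡ eval u σ

  Decomposition : ∀ {n} → (Valuation n → Set) → Set
  Decomposition {n} Q =
    (∀ σ → ¬ Q σ) ⊎ Σ (List (Binding n)) λ bs → ∀ σ → Q σ ⇔ All (Holds σ) bs

  trivial : ∀ {n} {Q : Valuation n → Set} → (∀ σ → Q σ) → Decomposition Q
  trivial q = inj₂ ([] , λ σ → mk⇔ (const []) (const (q σ)))

  bind : ∀ {n} i (u : UTerm n) → Decomposition (λ σ → σ i ≡ eval u σ)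
  bind i u = inj₂ ((i , u) ∷ [] , λ σ → mk⇔ (_∷ []) (λ { (e ∷ []) → e }))

  transport : ∀ {n} {Q Q′ : Valuation n → Set} →
              (∀ σ → Q σ ⇔ Q′ σ) → Decomposition Q → Decomposition Q′
  transport e (inj₁ ¬q)        = inj₁ λ σ q′ → ¬q σ (Equivalence.from (e σ) q′)
  transport e (inj₂ (bs , d))  = inj₂ (bs , λ σ → ⇔.trans (⇔.sym (e σ)) (d σ))

  both : ∀ {n} {Q₁ Q₂ : Valuation n → Set} →
         Decomposition Q₁ → Decomposition Q₂ → Decomposition (λ σ → Q₁ σ × Q₂ σ)
  both (inj₁ ¬q₁) _ = inj₁ λ σ q → ¬q₁ σ (proj₁ q)
  both (inj₂ _) (inj₁ ¬q₂) = inj₁ λ σ q → ¬q₂ σ (proj₂ q)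
  both (inj₂ (bs , d₁)) (inj₂ (cs , d₂)) = inj₂ (bs ++ cs , λ σ →
    mk⇔ (λ (q₁ , q₂) → ++⁺ (Equivalence.to (d₁ σ) q₁) (Equivalence.to (d₂ σ) q₂))
        (λ a → Equivalence.from (d₁ σ) (++⁻ˡ bs a) , Equivalence.from (d₂ σ) (++⁻ʳ bs a)))

  fn-injective : ∀ {f g ts us} → Term.fn f ts ≡ fn g us → f ≡ g × ts ≡ us
  fn-injective refl = refl , refl

  mutual
    decompose : ∀ {n} (s t : UTerm n) → Decomposition (λ σ → eval s σ ≡ eval t σ)
    decompose (var i) t = bind i t
    decompose s (var j) = transport (λ σ → mk⇔ sym sym) (bind j s)
    decompose (con c) (con d) with c ℕₚ.≟ d
    ... | yes refl = trivial λ σ → refl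
    ... | no c≢d   = inj₁ λ { σ refl → c≢d refl }
    decompose (con c) (fn g ts) = inj₁ λ σ ()
    decompose (fn f ss) (con d) = inj₁ λ σ ()
    decompose (fn f ss) (fn g ts) with f ℕₚ.≟ g
    ... | no f≢g   = inj₁ λ σ e → f≢g (proj₁ (fn-injective e))
    ... | yes refl = transport (λ σ → mk⇔ (cong (fn f)) (proj₂ ∘ fn-injective)) (decompose* ss ts)

    decompose* : ∀ {n} (ss ts : List (UTerm n)) → Decomposition (λ σ → eval* ss σ ≡ eval* ts σ)
    decompose* []       []       = trivial λ σ → refl
    decompose* (s ∷ ss) (t ∷ ts) =
      transport (λ σ → mk⇔ (λ (e , es) → cong₂ _∷_ e es) ∷-injective) (both (decompose s t) (decompose* ss ts))
    decompose* []      (_ ∷ _) = inj₁ λ σ ()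
    decompose* (_ ∷ _) []      = inj₁ λ σ ()

  Equation : ℕ → Set
  Equation n = UTerm n × UTerm n

  Sat : ∀ {n} → Valuation n → Equation n → Set
  Sat σ (s , t) = eval s σ ≡ eval t σ

  decomposeAll : ∀ {n} (E : List (Equation n)) → Decomposition (λ σ → All (Sat σ) E)
  decomposeAll []            = trivial λ σ → []
  decomposeAll ((s , t) ∷ E) =
    transport (λ σ → mk⇔ (λ (e , a) → e ∷ a) λ { (e ∷ a) → e , a }) (both (decompose s t) (decomposeAll E))

  elim : ∀ {m} (i : Fin (suc m)) → UTerm m → Fin (suc m) → UTerm m
  elim i w j with i ≟ᶠ j
  ... | yes _  = w
  ... | no i≢j = var (punchOut i≢j)

  elim-self : ∀ {m} (i : Fin (suc m)) w → elim i w i ≡ w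
  elim-self i w with i ≟ᶠ i
  ... | yes _  = refl
  ... | no i≢i = ⊥-elim (i≢i refl)

  eval-elim-apart : ∀ {m} (i : Fin (suc m)) w σ {j} → i ≢ j → eval (elim i w j) (σ ∘ punchIn i) ≡ σ j
  eval-elim-apart i w σ {j} i≢j with i ≟ᶠ j
  ... | yes i≡j  = ⊥-elim (i≢j i≡j)
  ... | no i≢j′ = cong σ (punchIn-punchOut i≢j′)

  elim-apart : ∀ {m} (i : Fin (suc m)) w w′ {j} → i ≢ j → elim i w j ≡ elim i w′ j
  elim-apart i w w′ {j} i≢j with i ≟ᶠ j
  ... | yes i≡j = ⊥-elim (i≢j i≡j)
  ... | no _    = refl

  -- a term not containing i, read over the remaining variables
  strengthen : ∀ {m} (i : Fin (suc m)) → UTerm (suc m) → UTerm m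
  strengthen i u = u ⟨ elim i (con 0) ⟩

  apart : ∀ {n} {i j : Fin n} {u} → ¬ Occ i u → Occ j u → i ≢ j
  apart ¬o o refl = ¬o o

  eliminate : ∀ {m} (i : Fin (suc m)) (u : UTerm (suc m)) → List (Binding (suc m)) → List (Equation m)
  eliminate i u = map λ (j , v) → elim i (strengthen i u) j , v ⟨ elim i (strengthen i u) ⟩

  eliminate-sound : ∀ {m} i u → ¬ Occ i u → ∀ bs (σ : Valuation m) → All (Sat σ) (eliminate i u bs) →
                    All (Holds (λ j → eval (elim i (strengthen i u) j) σ)) ((i , u) ∷ bs)
  eliminate-sound i u ¬o bs σ sat = holds-i ∷ rest bs sat
    where
    ρ = elim i (strengthen i u)
    σ′ : Valuation _
    σ′ j = eval (ρ j) σ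
    holds-i : σ′ i ≡ eval u σ′
    holds-i = begin
      eval (ρ i) σ                                  ≡⟨ cong (λ w → eval w σ) (elim-self i _) ⟩
      eval (strengthen i u) σ                       ≡⟨ eval-subst u _ σ ⟩
      eval u (λ j → eval (elim i (con 0) j) σ)      ≡⟨ eval-ext u (λ j o → cong (λ w → eval w σ)
                                                         (elim-apart i (con 0) _ (apart ¬o o))) ⟩
      eval u σ′                                     ∎
      where open ≡-Reasoning
    rest : ∀ bs → All (Sat σ) (eliminate i u bs) → All (Holds σ′) bs
    rest []             []        = []
    rest ((j , v) ∷ bs) (e ∷ sat) = trans e (eval-subst v ρ σ) ∷ rest bs sat

  eliminate-complete : ∀ {m} i u → ¬ Occ i u → ∀ bs (σ : Valuation (suc m)) →
                       All (Holds σ) ((i , u) ∷ bs) → All (Sat (σ ∘ punchIn i)) (eliminate i u bs)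
  eliminate-complete i u ¬o bs σ (σi ∷ hs) = rest bs hs
    where
    ρ = elim i (strengthen i u)
    agrees : ∀ j → eval (ρ j) (σ ∘ punchIn i) ≡ σ j
    agrees j with i ≟ᶠ j
    ... | no i≢j   = cong σ (punchIn-punchOut i≢j)
    ... | yes refl = begin
      eval (strengthen i u) (σ ∘ punchIn i)                    ≡⟨ eval-subst u _ (σ ∘ punchIn i) ⟩
      eval u (λ j → eval (elim i (con 0) j) (σ ∘ punchIn i))   ≡⟨ eval-ext u (λ j o → eval-elim-apart i _ σ (apart ¬o o)) ⟩
      eval u σ                                                 ≡⟨ sym σi ⟩
      σ i                                                      ∎
      where open ≡-Reasoning
    rest : ∀ bs → All (Holds σ) bs → All (Sat (σ ∘ punchIn i)) (eliminate i u bs)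
    rest []             []       = []
    rest ((j , v) ∷ bs) (h ∷ hs) =
      trans (agrees j) (trans h (trans (eval-ext v (λ k _ → sym (agrees k))) (sym (eval-subst v ρ _))))
      ∷ rest bs hs

  Solvable : ∀ {n} → List (Equation n) → Set
  Solvable {n} E = Σ (Valuation n) λ σ → All (Sat σ) E

  Solutions : ∀ {n} → List (Binding n) → Set
  Solutions {n} bs = Σ (Valuation n) λ σ → All (Holds σ) bs

  first-binding : ∀ {m} i u (bs : List (Binding (suc m))) → Dec (Occ i u) →
                  Dec (Solutions bs) → Dec (Solvable (eliminate i u bs)) → Dec (Solutions ((i , u) ∷ bs))
  first-binding i _ bs (yes occ-var) rest _ =
    map′ (λ (σ , a) → σ , refl ∷ a) (λ { (σ , _ ∷ a) → σ , a }) rest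
  first-binding i _ bs (yes (occ-fn o)) _ _ = no λ { (σ , e ∷ _) → occurs-check σ o e }
  first-binding i u bs (no ¬o) _ reduced =
    map′ (λ (σ , a) → _ , eliminate-sound i u ¬o bs σ a)
         (λ (σ , a) → σ ∘ punchIn i , eliminate-complete i u ¬o bs σ a)
         reduced

  -- The unification algorithm; a decomposed system is solvable iff its
  -- bindings are.  Recursion is on the number of variables, and on the
  -- list of bindings for a fixed number.
  mutual
    solvable? : ∀ n (E : List (Equation n)) → Dec (Solvable E)
    solvable? n E = solve-decomposed n (decomposeAll E)

    solve-decomposed : ∀ n {Q : Valuation n → Set} → Decomposition Q → Dec (Σ (Valuation n) Q)
    solve-decomposed n (inj₁ ¬sol)     = no λ (σ , q) → ¬sol σ q
    solve-decomposed n (inj₂ (bs , d)) =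
      map′ (λ (σ , a) → σ , Equivalence.from (d σ) a) (λ (σ , q) → σ , Equivalence.to (d σ) q) (bindings? n bs)

    bindings? : ∀ n (bs : List (Binding n)) → Dec (Solutions bs)
    bindings? n       []               = yes (const (con 0) , [])
    bindings? (suc m) ((i , u) ∷ bs) =
      first-binding i u bs (occ? i u) (bindings? (suc m) bs) (solvable? m (eliminate i u bs))

-- Unification of equations between ordinary terms, by translation to
-- terms over the finitely many variables 0 … M of the system.
open Unification using (UTerm; eval; Equation; Sat; solvable?)

Solves : Subst → Term × Term → Set
Solves σ (s , t) = s ⟪ σ ⟫ ≡ t ⟪ σ ⟫

Unifiable : List (Term × Term) → Set
Unifiable E = Σ Subst λ σ → All (Solves σ) E

mutual
  maxVar : Term → ℕ
  maxVar (var x)   = x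
  maxVar (con c)   = 0
  maxVar (fn f ts) = maxVar* ts

  maxVar* : List Term → ℕ
  maxVar* []       = 0
  maxVar* (t ∷ ts) = maxVar t ⊔ maxVar* ts

mutual
  occurs≤maxVar : ∀ {x} t → x occursIn t → x ≤ maxVar t
  occurs≤maxVar (var x)   here-var = ℕₚ.≤-refl
  occurs≤maxVar (fn f ts) (in-fn o) = occurs≤maxVar* ts o

  occurs≤maxVar* : ∀ {x} ts → Any (x occursIn_) ts → x ≤ maxVar* ts
  occurs≤maxVar* (t ∷ ts) (here o)  = ℕₚ.≤-trans (occurs≤maxVar t o) (ℕₚ.m≤m⊔n (maxVar t) (maxVar* ts))
  occurs≤maxVar* (t ∷ ts) (there o) = ℕₚ.≤-trans (occurs≤maxVar* ts o) (ℕₚ.m≤n⊔m (maxVar t) (maxVar* ts))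

maxVarEqs : List (Term × Term) → ℕ
maxVarEqs []            = 0
maxVarEqs ((s , t) ∷ E) = maxVar s ⊔ (maxVar t ⊔ maxVarEqs E)

module Translation (M : ℕ) where

  mutual
    toU : Term → UTerm (suc M)
    toU (var x)   = UTerm.var (x mod suc M)
    toU (con c)   = UTerm.con c
    toU (fn f ts) = UTerm.fn f (toU* ts)

    toU* : List Term → List (UTerm (suc M))
    toU* []       = []
    toU* (t ∷ ts) = toU t ∷ toU* ts

  mutual
    eval-toU : ∀ t τ → eval (toU t) τ ≡ t ⟪ (λ x → τ (x mod suc M)) ⟫
    eval-toU (var x)   τ = refl
    eval-toU (con c)   τ = refl
    eval-toU (fn f ts) τ = cong (fn f) (eval-toU* ts τ)

    eval-toU* : ∀ ts τ → Unification.eval* (toU* ts) τ ≡ ts ⟪ (λ x → τ (x mod suc M)) ⟫*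
    eval-toU* []       τ = refl
    eval-toU* (t ∷ ts) τ = cong₂ _∷_ (eval-toU t τ) (eval-toU* ts τ)

  -- below the bound, x mod (M + 1) is x itself
  eval-toU-bounded : ∀ t (σ : Subst) → maxVar t ≤ M → eval (toU t) (σ ∘ toℕ) ≡ t ⟪ σ ⟫
  eval-toU-bounded t σ bound = trans (eval-toU t (σ ∘ toℕ)) (subst-ext t λ x o →
    cong σ (trans (toℕ-fromℕ< _) (m<n⇒m%n≡m (s≤s (ℕₚ.≤-trans (occurs≤maxVar t o) bound)))))

  toEqs : List (Term × Term) → List (Equation (suc M))
  toEqs = map λ (s , t) → toU s , toU t

  toEqs-sound : ∀ E τ → All (Sat τ) (toEqs E) → All (Solves (λ x → τ (x mod suc M))) E
  toEqs-sound []            τ []        = []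
  toEqs-sound ((s , t) ∷ E) τ (e ∷ sat) =
    trans (sym (eval-toU s τ)) (trans e (eval-toU t τ)) ∷ toEqs-sound E τ sat

  toEqs-complete : ∀ E σ → maxVarEqs E ≤ M → All (Solves σ) E → All (Sat (σ ∘ toℕ)) (toEqs E)
  toEqs-complete []            σ bound []        = []
  toEqs-complete ((s , t) ∷ E) σ bound (e ∷ sol) =
    trans (eval-toU-bounded s σ bound-s) (trans e (sym (eval-toU-bounded t σ bound-t)))
    ∷ toEqs-complete E σ bound-E sol
    where
    bound-s = ℕₚ.m⊔n≤o⇒m≤o (maxVar s) _ bound
    bound-t = ℕₚ.m⊔n≤o⇒m≤o (maxVar t) _ (ℕₚ.m⊔n≤o⇒n≤o (maxVar s) _ bound)
    bound-E = ℕₚ.m⊔n≤o⇒n≤o (maxVar t) _ (ℕₚ.m⊔n≤o⇒n≤o (maxVar s) _ bound)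

unifiable? : (E : List (Term × Term)) → Dec (Unifiable E)
unifiable? E =
  map′ (λ (τ , sat) → _ , toEqs-sound E τ sat)
       (λ (σ , sol) → σ ∘ toℕ , toEqs-complete E σ ℕₚ.≤-refl sol)
       (solvable? _ (toEqs E))
  where open Translation (maxVarEqs E)

any∈? : ∀ {A : Set} (xs : List A) {Ψ : ∀ {x} → x ∈ xs → Set} →
        (∀ {x} (p : x ∈ xs) → Dec (Ψ p)) → Dec (∃[ x ] Σ (x ∈ xs) Ψ)
any∈? []       Ψ? = no λ ()
any∈? (x ∷ xs) Ψ? with Ψ? (here refl) | any∈? xs (λ p → Ψ? (there p))
... | yes ψ | _                = yes (x , here refl , ψ)
... | no _  | yes (y , p , ψ) = yes (y , there p , ψ)
... | no ¬ψ | no ¬rest         =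
  no λ { (_ , here refl , ψ) → ¬ψ ψ ; (y , there p , ψ) → ¬rest (y , p , ψ) }

module Walks {A : Set} (_≟_ : DecidableEquality A) (E : A → A → Set) where
  open DecMembership _≟_ using (_∈?_)

  data Walk : ℕ → A → A → Set where
    start : ∀ {a} → Walk 0 a a
    _▷_   : ∀ {n a b c} → Walk n a b → E b c → Walk (suc n) a c

  targets : ∀ {n a b} → Walk n a b → List A
  targets start                = []
  targets (_▷_ {c = c} w e) = c ∷ targets w

  reach : ∀ {n a b c} (w : Walk n a b) → c ∈ targets w → Star E c b
  reach (w ▷ e) (here refl) = ε
  reach (w ▷ e) (there p)   = reach w p ◅◅ (e ◅ ε)

  star-then : ∀ {a b c} → Star E a b → E b c → TransClosure E a c
  star-then ε       e = [ e ]
  star-then (d ◅ s) e = d ∷ star-then s e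

  cycle-before-end : ∀ (Q : List A) {n a b} (w : Walk n a b) → All (_∈ Q) (targets w) → length Q < n →
                     ∃[ c ] TransClosure E c c × Star E c b
  cycle-before-end Q start _ ()
  cycle-before-end Q (_▷_ {c = b} w e) (b∈Q ∷ inQ) |Q|<n with b ∈? targets w
  ... | yes b∈w = b , star-then (reach w b∈w) e , ε
  ... | no b∉w  =
    let c , cycle , c⇝ = cycle-before-end Q∖b w inQ∖b |Q∖b|<n in c , cycle , c⇝ ◅◅ (e ◅ ε)
    where
    Q∖b = filter (λ x → ¬? (b ≟ x)) Q
    inQ∖b : All (_∈ Q∖b) (targets w)
    inQ∖b = All.zipWith (λ (x∈Q , b≢x) → ∈-filter⁺ (λ x → ¬? (b ≟ x)) x∈Q b≢x) (inQ , ¬Any⇒All¬ _ b∉w)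
    |Q∖b|<n : length Q∖b < _
    |Q∖b|<n = ℕₚ.<-≤-trans (filter-notAll (λ x → ¬? (b ≟ x)) Q (lose b∈Q λ b≢b → b≢b refl)) (ℕₚ.≤-pred |Q|<n)

-- Renaming apart.  The variables of successive rules of a chain are kept
-- apart by sending those of the top rule to even numbers and those of
-- the rest of the chain to odd numbers.
rename : (ℕ → ℕ) → Term → Term
rename ρ t = t ⟪ var ∘ ρ ⟫

renameEq : (ℕ → ℕ) → Term × Term → Term × Term
renameEq ρ (s , t) = rename ρ s , rename ρ t

rename-subst : ∀ ρ t (σ : Subst) → rename ρ t ⟪ σ ⟫ ≡ t ⟪ σ ∘ ρ ⟫
rename-subst ρ t σ = subst-comp t (var ∘ ρ) σ

subst-cong : ∀ t {θ₁ θ₂ : Subst} → (∀ x → θ₁ x ≡ θ₂ x) → t ⟪ θ₁ ⟫ ≡ t ⟪ θ₂ ⟫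
subst-cong t h = subst-ext t (λ x _ → h x)

renamed-solution : ∀ ρ σ E → All (Solves σ) (map (renameEq ρ) E) → All (Solves (σ ∘ ρ)) E
renamed-solution ρ σ []            []        = []
renamed-solution ρ σ ((s , t) ∷ E) (e ∷ sol) =
  trans (sym (rename-subst ρ s σ)) (trans e (rename-subst ρ t σ)) ∷ renamed-solution ρ σ E sol

renaming-solution : ∀ ρ σ {σ′} → (∀ x → σ (ρ x) ≡ σ′ x) → ∀ E → All (Solves σ′) E →
                    All (Solves σ) (map (renameEq ρ) E)
renaming-solution ρ σ agree []            []        = []
renaming-solution ρ σ agree ((s , t) ∷ E) (e ∷ sol) =
  trans (trans (rename-subst ρ s σ) (subst-cong s agree))
        (trans e (sym (trans (rename-subst ρ t σ) (subst-cong t agree))))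
  ∷ renaming-solution ρ σ agree E sol

even odd : ℕ → ℕ
even zero    = zero
even (suc x) = suc (suc (even x))
odd x = suc (even x)

interleave : Subst → Subst → Subst
interleave θ σ zero          = θ 0
interleave θ σ (suc zero)    = σ 0
interleave θ σ (suc (suc y)) = interleave (θ ∘ suc) (σ ∘ suc) y

interleave-even : ∀ θ σ x → interleave θ σ (even x) ≡ θ x
interleave-even θ σ zero    = refl
interleave-even θ σ (suc x) = interleave-even (θ ∘ suc) (σ ∘ suc) x

interleave-odd : ∀ θ σ x → interleave θ σ (odd x) ≡ σ x
interleave-odd θ σ zero    = refl
interleave-odd θ σ (suc x) = interleave-odd (θ ∘ suc) (σ ∘ suc) x

∈-concatMap⁺′ : ∀ {A B : Set} {f : A → List B} {x xs y} → x ∈ xs → y ∈ f x → y ∈ concatMap f xs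
∈-concatMap⁺′ {f = f} {y = y} x∈ y∈ = ∈-concatMap⁺ f (lose {P = λ x → y ∈ f x} x∈ y∈)

tuples : ∀ {A : Set} → ℕ → List A → List (List A)
tuples zero    L = [] ∷ []
tuples (suc a) L = concatMap (λ x → map (x ∷_) (tuples a L)) L

∈-tuples : ∀ {A : Set} {L : List A} {xs} → All (_∈ L) xs → xs ∈ tuples (length xs) L
∈-tuples []          = here refl
∈-tuples (x∈ ∷ xs∈) = ∈-concatMap⁺′ x∈ (∈-map⁺ _ (∈-tuples xs∈))

mutual
  constants : Term → List ℕ
  constants (var x)   = []
  constants (con c)   = c ∷ []
  constants (fn f ts) = constants* ts

  constants* : List Term → List ℕ
  constants* []       = []
  constants* (t ∷ ts) = constants t ++ constants* ts

mutual
  symbols : Term → List (ℕ × ℕ)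
  symbols (var x)   = []
  symbols (con c)   = []
  symbols (fn f ts) = (f , length ts) ∷ symbols* ts

  symbols* : List Term → List (ℕ × ℕ)
  symbols* []       = []
  symbols* (t ∷ ts) = symbols t ++ symbols* ts

module _ (P : Program) where

  Node : Set
  Node = Rule × Subst

  data Link : Node → Node → Set where
    link : ∀ {q θq s θ B} → q ∈ P → s ∈ P → B ∈ body s → head q · θq ≡ B · θ → Link (q , θq) (s , θ)

  data Chain : ℕ → Node → Node → Set where
    nil : ∀ {u} → Chain 0 u u
    _▸_ : ∀ {n u v w} → Chain n u v → Link v w → Chain (suc n) u w

  ChainInto : ℕ → Rule → Subst → Set
  ChainInto n s θ = ∃[ u ] Chain n u (s , θ)

  -- An instance of s whose body holds at stage i either has its head
  -- derived at stage i already, or is the top of a chain of i links: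
  -- follow a premise that is new at its stage.
  mutual
    derived-or-chain : ∀ i {s θ} → s ∈ P → GroundSubst θ → All (λ B → T P i (B · θ)) (body s) →
                       T P i (head s · θ) ⊎ ChainInto i s θ
    derived-or-chain zero s∈ g premises = inj₂ (_ , nil)
    derived-or-chain (suc j) {s} {θ} s∈ g premises with older-or-chain j s∈ (body s) (λ B∈ → B∈) premises
    ... | inj₁ older = inj₁ (s , s∈ , θ , g , refl , older)
    ... | inj₂ chain = inj₂ chain

    older-or-chain : ∀ j {s θ} → s ∈ P → (Bs : List Atom) → Bs ⊆ body s →
                     All (λ B → T P (suc j) (B · θ)) Bs → All (λ B → T P j (B · θ)) Bs ⊎ ChainInto (suc j) s θ
    older-or-chain j s∈ []       _     []   = inj₁ []
    older-or-chain j s∈ (B ∷ Bs) ⊆body ((q , q∈ , θq , gq , eq , premises) ∷ rest)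
      with derived-or-chain j q∈ gq premises
    ... | inj₂ (u , c) = inj₂ (u , c ▸ link q∈ s∈ (⊆body (here refl)) eq)
    ... | inj₁ derived with older-or-chain j s∈ Bs (⊆body ∘ there) rest
    ...   | inj₁ older = inj₁ (subst (T P j) eq derived ∷ older)
    ...   | inj₂ chain = inj₂ chain

  shorten : ∀ {m n u w} → m ≤ n → Chain n u w → ∃[ v ] Chain m v w
  shorten z≤n       _       = _ , nil
  shorten (s≤s m≤n) (c ▸ l) = let v , c′ = shorten m≤n c in v , c′ ▸ l

  split : ∀ k m {u w} → Chain (k + m) u w → ∃[ v ] Chain m u v × Chain k v w
  split zero    m c       = _ , c , nil
  split (suc k) m (c ▸ l) = let v , lower , upper = split k m c in v , lower , upper ▸ l

  uncons : ∀ {n u w} → Chain (suc n) u w → ∃[ v ] Link u v × Chain n v w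
  uncons (nil ▸ l)        = _ , l , nil
  uncons ((c ▸ l′) ▸ l) = let v , first , rest = uncons (c ▸ l′) in v , first , rest ▸ l

  chain⇒active : ∀ n {u w} → Chain (suc n) u w → ∀ {H} σ → H · σ ≡ head (proj₁ u) · proj₂ u →
                 APath P (suc n) H (proj₁ w)
  chain⇒active n c σ H≡ with uncons c
  chain⇒active zero    c σ H≡ | (s , θ) , link _ s∈ B∈ eq , nil  = last σ θ s∈ B∈ (trans H≡ eq)
  chain⇒active (suc n) c σ H≡ | (s , θ) , link _ s∈ B∈ eq , rest =
    cons σ θ s∈ B∈ (trans H≡ eq) (chain⇒active n rest var (atom-id _))

  chain⇒edge : ∀ k {u w} → Chain (suc k) u w → EdgeΣ (suc k) P (proj₁ u) (proj₁ w)
  chain⇒edge k c@(_ ▸ link _ w∈ _ _) with uncons c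
  ... | _ , link u∈ _ _ _ , _ = u∈ , w∈ , chain⇒active k c _ refl

  -- A chain of (|P| + 1)(k + 1) links into r makes r depend on a cycle of
  -- Σ_{k+1}(P): its blocks of k + 1 links form a walk of |P| + 1 edges,
  -- which must repeat a rule.
  module _ (k : ℕ) where
    open Walks _≟ʳ_ (EdgeΣ (suc k) P)

    blocks : ∀ j {u w} → Chain (j * suc k) u w → Walk j (proj₁ u) (proj₁ w)
    blocks zero    nil = start
    blocks (suc j) c   = let _ , lower , upper = split (suc k) (j * suc k) c in blocks j lower ▷ chain⇒edge k upper

    targets-in-P : ∀ {j a b} (w : Walk j a b) → All (_∈ P) (targets w)
    targets-in-P start                = []
    targets-in-P (w ▷ (_ , b∈ , _)) = b∈ ∷ targets-in-P w

    cycle-in-P : ∀ {c} → TransClosure (EdgeΣ (suc k) P) c c → c ∈ P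
    cycle-in-P [ e ]   = proj₁ e
    cycle-in-P (e ∷ _) = proj₁ e

    long-chain⇒cycle : ∀ {r θ} → ChainInto (suc (length P) * suc k) r θ → DependsOnCycle (suc k) P r
    long-chain⇒cycle (_ , chain) =
      let walk = blocks (suc (length P)) chain
          c , cycle , c⇝r = cycle-before-end P walk (targets-in-P walk) (ℕₚ.n<1+n (length P))
      in c , cycle-in-P cycle , cycle , c⇝r

  data Skeleton : ℕ → Rule → Set where
    top   : ∀ {s} → Skeleton 0 s
    below : ∀ {n s} q → q ∈ P → ∀ B → B ∈ body s → Skeleton n q → Skeleton (suc n) s

  shape : ∀ {n u s θ} → Chain n u (s , θ) → Skeleton n s
  shape nil                             = top
  shape (c ▸ link {q} {B = B} q∈ _ B∈ _) = below q q∈ B B∈ (shape c)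

  -- Skeletons are finitely branching, so searching them is decidable.
  skeleton? : ∀ n s (Φ : Skeleton n s → Set) → (∀ sk → Dec (Φ sk)) → Dec (Σ (Skeleton n s) Φ)
  skeleton? zero s Φ Φ? = map′ (top ,_) (λ { (top , φ) → φ }) (Φ? top)
  skeleton? (suc n) s Φ Φ? =
    map′ (λ (q , q∈ , B , B∈ , sk , φ) → below q q∈ B B∈ sk , φ)
         (λ { (below q q∈ B B∈ sk , φ) → q , q∈ , B , B∈ , sk , φ })
         (any∈? P λ q∈ → any∈? (body s) λ B∈ → skeleton? n _ _ (Φ? ∘ below _ q∈ _ B∈))

  -- The chains of a given skeleton are the solutions of a system of
  -- equations: the top rule is renamed to even variables and the chain
  -- below it to odd ones.
  equations : ∀ {n s} → Skeleton n s → List (Term × Term)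
  equations top                  = []
  equations (below q _ B _ sk) =
    (rename (odd ∘ even) (atomTerm (head q)) , rename even (atomTerm B)) ∷ map (renameEq odd) (equations sk)

  solution⇒chain : ∀ {n s} → s ∈ P → (sk : Skeleton n s) (σ : Subst) → All (Solves σ) (equations sk) →
                   ChainInto n s (σ ∘ even)
  solution⇒chain s∈ top                    σ []        = _ , nil
  solution⇒chain s∈ (below q q∈ B B∈ sk) σ (e ∷ sol) =
    let u , c = solution⇒chain q∈ sk (σ ∘ odd) (renamed-solution odd σ _ sol)
    in u , c ▸ link q∈ s∈ B∈ (atomTerm-injective matched)
    where
    open ≡-Reasoning
    matched : atomTerm (head q · (σ ∘ odd ∘ even)) ≡ atomTerm (B · (σ ∘ even))
    matched = begin
      atomTerm (head q · (σ ∘ odd ∘ even))      ≡⟨ atomTerm-subst (head q) _ ⟩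
      atomTerm (head q) ⟪ σ ∘ odd ∘ even ⟫       ≡⟨ rename-subst (odd ∘ even) (atomTerm (head q)) σ ⟨
      rename (odd ∘ even) (atomTerm (head q)) ⟪ σ ⟫ ≡⟨ e ⟩
      rename even (atomTerm B) ⟪ σ ⟫             ≡⟨ rename-subst even (atomTerm B) σ ⟩
      atomTerm B ⟪ σ ∘ even ⟫                    ≡⟨ atomTerm-subst B _ ⟨
      atomTerm (B · (σ ∘ even))                  ∎

  chain⇒solution : ∀ {n u s θ} (c : Chain n u (s , θ)) →
                   ∃[ σ ] All (Solves σ) (equations (shape c)) × (∀ x → σ (even x) ≡ θ x)
  chain⇒solution {θ = θ} nil = interleave θ θ , [] , interleave-even θ θ
  chain⇒solution {θ = θ} (c ▸ link {q} {θq} {B = B} q∈ s∈ B∈ eq) =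
    let σq , sol , σq-top = chain⇒solution c
        σ = interleave θ σq
        matched : Solves σ (rename (odd ∘ even) (atomTerm (head q)) , rename even (atomTerm B))
        matched = begin
          rename (odd ∘ even) (atomTerm (head q)) ⟪ σ ⟫ ≡⟨ rename-subst (odd ∘ even) (atomTerm (head q)) σ ⟩
          atomTerm (head q) ⟪ σ ∘ odd ∘ even ⟫          ≡⟨ subst-cong (atomTerm (head q))
                                                            (λ x → trans (interleave-odd θ σq (even x)) (σq-top x)) ⟩
          atomTerm (head q) ⟪ θq ⟫                       ≡⟨ atomTerm-subst (head q) θq ⟨
          atomTerm (head q · θq)                         ≡⟨ cong atomTerm eq ⟩
          atomTerm (B · θ)                               ≡⟨ atomTerm-subst B θ ⟩
          atomTerm B ⟪ θ ⟫                               ≡⟨ subst-cong (atomTerm B) (interleave-even θ σq) ⟨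
          atomTerm B ⟪ σ ∘ even ⟫                        ≡⟨ rename-subst even (atomTerm B) σ ⟨
          rename even (atomTerm B) ⟪ σ ⟫                 ∎
    in σ , matched ∷ renaming-solution odd σ (interleave-odd θ σq) _ sol , interleave-even θ σq
    where open ≡-Reasoning

  chainInto? : ∀ n {s} → s ∈ P → Dec (∃[ θ ] ChainInto n s θ)
  chainInto? n {s} s∈ =
    map′ (λ (sk , σ , sol) → σ ∘ even , solution⇒chain s∈ sk σ sol)
         (λ (θ , _ , c) → let σ , sol , _ = chain⇒solution c in shape c , σ , sol)
         (skeleton? n s (Unifiable ∘ equations) (unifiable? ∘ equations))

  headArgs : Rule → List Term
  headArgs r = args (head r)

  Cs : List ℕ
  Cs = concatMap (constants* ∘ headArgs) P

  Fs : List (ℕ × ℕ)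
  Fs = concatMap (symbols* ∘ headArgs) P

  Ps : List (ℕ × ℕ)
  Ps = map (λ r → pred (head r) , length (headArgs r)) P

  data Small : ℕ → Term → Set where
    small-con : ∀ {d c} → c ∈ Cs → Small d (con c)
    small-fn  : ∀ {d f ts} → (f , length ts) ∈ Fs → All (Small d) ts → Small (suc d) (fn f ts)

  SmallAtom : ℕ → Atom → Set
  SmallAtom d A = (pred A , length (args A)) ∈ Ps × All (Small d) (args A)

  mutual
    small-mono : ∀ {d d′ t} → d ≤ d′ → Small d t → Small d′ t
    small-mono _         (small-con c∈)       = small-con c∈
    small-mono (s≤s d≤d′) (small-fn f∈ small) = small-fn f∈ (small-mono* d≤d′ small)

    small-mono* : ∀ {d d′ ts} → d ≤ d′ → All (Small d) ts → All (Small d′) ts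
    small-mono* d≤d′ []             = []
    small-mono* d≤d′ (small ∷ smalls) = small-mono d≤d′ small ∷ small-mono* d≤d′ smalls

  smallTerms : ℕ → List Term
  smallTerms zero    = map con Cs
  smallTerms (suc d) = map con Cs ++ concatMap (λ (f , a) → map (fn f) (tuples a (smallTerms d))) Fs

  mutual
    ∈-smallTerms : ∀ {d t} → Small d t → t ∈ smallTerms d
    ∈-smallTerms {zero}  (small-con c∈)       = ∈-map⁺ con c∈
    ∈-smallTerms {suc d} (small-con c∈)       = ++⁺ˡ (∈-map⁺ con c∈)
    ∈-smallTerms {suc d} (small-fn f∈ smalls) =
      ++⁺ʳ (map con Cs) (∈-concatMap⁺′ f∈ (∈-map⁺ _ (∈-tuples (∈-smallTerms* smalls))))

    ∈-smallTerms* : ∀ {d ts} → All (Small d) ts → All (_∈ smallTerms d) ts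
    ∈-smallTerms* []               = []
    ∈-smallTerms* (small ∷ smalls) = ∈-smallTerms small ∷ ∈-smallTerms* smalls

  smallAtoms : ℕ → List Atom
  smallAtoms d = concatMap (λ (p , a) → map (atom p) (tuples a (smallTerms d))) Ps

  ∈-smallAtoms : ∀ {d A} → SmallAtom d A → A ∈ smallAtoms d
  ∈-smallAtoms (p∈ , smalls) = ∈-concatMap⁺′ p∈ (∈-map⁺ _ (∈-tuples (∈-smallTerms* smalls)))

  mutual
    small-occ : ∀ {d x} t (θ : Subst) → x occursIn t → Small d (t ⟪ θ ⟫) → Small d (θ x)
    small-occ (var x)   θ here-var  small                = small
    small-occ (fn f ts) θ (in-fn o) (small-fn _ smalls) = small-mono (ℕₚ.n≤1+n _) (small-occ* ts θ o smalls)

    small-occ* : ∀ {d x} ts (θ : Subst) → Any (x occursIn_) ts → All (Small d) (ts ⟪ θ ⟫*) → Small d (θ x)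
    small-occ* (t ∷ ts) θ (here o)  (small ∷ _) = small-occ t θ o small
    small-occ* (t ∷ ts) θ (there o) (_ ∷ smalls) = small-occ* ts θ o smalls

  module _ {d : ℕ} (θ : Subst) where
    simple-instance* : ∀ ts → All Simple ts → constants* ts ⊆ Cs →
                       (∀ x → Any (x occursIn_) ts → Small d (θ x)) → All (Small d) (ts ⟪ θ ⟫*)
    simple-instance* []            []                     cs vars = []
    simple-instance* (var x ∷ ts) (simple-var .x ∷ simple) cs vars =
      vars x (here here-var) ∷ simple-instance* ts simple cs (λ y o → vars y (there o))
    simple-instance* (con c ∷ ts) (simple-con .c ∷ simple) cs vars =
      small-con (cs (here refl)) ∷ simple-instance* ts simple (cs ∘ there) (λ y o → vars y (there o))

    head-instance : ∀ t → DepthLe1 t → constants t ⊆ Cs → symbols t ⊆ Fs →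
                    (∀ x → x occursIn t → Small d (θ x)) → Small (suc d) (t ⟪ θ ⟫)
    head-instance (var x)   _      cs fs vars = small-mono (ℕₚ.n≤1+n d) (vars x here-var)
    head-instance (con c)   _      cs fs vars = small-con (cs (here refl))
    head-instance (fn f ts) simple cs fs vars =
      small-fn (subst (λ a → (f , a) ∈ Fs) (sym (subst-length ts θ)) (fs (here refl)))
               (simple-instance* ts simple cs (λ x o → vars x (in-fn o)))

    head-instance* : ∀ ts → All DepthLe1 ts → constants* ts ⊆ Cs → symbols* ts ⊆ Fs →
                     (∀ x → Any (x occursIn_) ts → Small d (θ x)) → All (Small (suc d)) (ts ⟪ θ ⟫*)
    head-instance* []       []           cs fs vars = []
    head-instance* (t ∷ ts) (depth ∷ depths) cs fs vars =
      head-instance t depth (cs ∘ ++⁺ˡ) (fs ∘ ++⁺ˡ) (λ x o → vars x (here o))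
      ∷ head-instance* ts depths (cs ∘ ++⁺ʳ (constants t)) (fs ∘ ++⁺ʳ (symbols t)) (λ x o → vars x (there o))

  -- By range restriction every head variable takes a value from a premise,
  -- so facts of stage i are small atoms of depth ≤ i.
  derived-small : Admissible P → ∀ i {A} → T P i A → SmallAtom i A
  derived-small adm (suc j) (s , s∈ , θ , _ , refl , premises) with All.lookup adm s∈
  ... | range-restricted , _ , head-depth , _ =
    subst (λ a → (pred (head s) , a) ∈ Ps) (sym (subst-length (headArgs s) θ)) (∈-map⁺ _ s∈) ,
    head-instance* θ (headArgs s) head-depth (∈-concatMap⁺′ s∈) (∈-concatMap⁺′ s∈) premise-values
    where
    premise-values : ∀ x → x occursInAtom head s → Small j (θ x)
    premise-values x o = All.lookupWith (λ {B} premise x∈B → small-occ* (args B) θ x∈B (proj₂ (derived-small adm j premise)))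
                                        premises (range-restricted x o)

  -- Without chains of K links into r, every fact of M⟦r⟧ is new at a stage
  -- below K, hence one of the finitely many small atoms of depth ≤ K.
  no-long-chain⇒finite : ∀ {K r} → Admissible P → r ∈ P → ¬ (∃[ θ ] ChainInto K r θ) → Finite (M⟦ r ⟧ P)
  no-long-chain⇒finite {K} {r} adm r∈ no-chain = smallAtoms K , bounded
    where
    bounded : ∀ A → M⟦ r ⟧ P A → A ∈ smallAtoms K
    bounded A (i , θ , g , refl , premises , new) with derived-or-chain i r∈ g premises
    ... | inj₁ old   = ⊥-elim (new old)
    ... | inj₂ (_ , chain) with K ≤? i
    ...   | yes K≤i = ⊥-elim (no-chain (θ , shorten K≤i chain))
    ...   | no K≰i  = ∈-smallAtoms (small-atom-mono (derived-small adm (suc i) (r , r∈ , θ , g , refl , premises)))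
      where
      small-atom-mono : ∀ {A} → SmallAtom (suc i) A → SmallAtom K A
      small-atom-mono (p∈ , smalls) = p∈ , small-mono* (ℕₚ.≰⇒> K≰i) smalls

theorem4 : (P : Program) → Admissible P → (r : Rule) → r ∈ P →
    Infinite (M⟦ r ⟧ P) → (k : ℕ) → k ≥ 1 → DependsOnCycle k P r
theorem4 P adm r r∈P infinite (suc k) _ with chainInto? P (suc (length P) * suc k) r∈P
... | yes (_ , chain) = long-chain⇒cycle P k chain
... | no no-chain     = ⊥-elim (infinite (no-long-chain⇒finite P adm r∈P no-chain))
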